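{- Let $n\ge1$, $h\ge1$, let $H$ be a multiset of $h$ binary strings of length $n$, let $M=M(H)$, and let $f$ be a cumulative weight function that is a solution to $M$. Then the numbers $\{b_{l,w},c_{l,w} : (l,w)\in[n]\times\{0,\dots,n\},\ w\le l\}$ are determined by (can be computed from) the numbers $\{a_{l,w} : (l,w)\in\{0,\dots,n\}^2,\ w\le l\}$ alone.
   Context: Notation: $[n]=\{1,\dots,n\}$. For a binary string $t$ of length $n$, $\mathrm{wt}(t)$ is its number of ones and $t[l]$, $t[-l]$ are its length-$l$ prefix and suffix. $M(t)$ is the multiset union of $\{(j-\mathrm{wt}(t[j]),\mathrm{wt}(t[j])) : j\in[n]\}$ and $\{(j-\mathrm{wt}(t[-j]),\mathrm{wt}(t[-j])) : j\in[n]\}$, and $M(H)$ is the multiset union of $M(t)$ over $t\in H$ with multiplicity. A cumulative weight function (CWF) is a map $f:\{0,\dots,n\}\times[2h]\to\{0,\dots,n\}$ with (a) $f(0,m)=0$ for all $m$; (b) $f(l,m)-f(l-1,m)\in\{0,1\}$ for $(l,m)\in[n]\times[2h]$; (c) for each $j\in[h]$ there is $w_j$ with $f(l,2j-1)+f(n-l,2j)=w_j$ for all $l\in\{0,\dots,n\}$. Write $f_m(l)=f(l,m)$. $f$ is a solution to $M$ if $M=\{(l-f_m(l),f_m(l)) : m\in[2h], l\in[n]\}$ as multisets. For $(l,w)\in\{0,\dots,n\}^2$, $A(l,w)=\{m\in[2h] : f_m(l)=w\}$, and $a_{l,w}$ is the number of pairs $(l-w,w)$ in $M$ if $(l,w)\ne(0,0)$,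 with $a_{0,0}=2h$. For $(l,w)\in[n]^2$, $b_{l,w}=|A(l,w)\cap A(l-1,w)|$ and $c_{l,w}=|A(l,w)\cap A(l-1,w-1)|$; moreover $b_{l,0}=|A(l,0)|$ and $c_{l,0}=0$ for $l\in[n]$. -}

module Defs where

open import Data.Bool using (Bool; true; false)
open import Data.Nat using (ℕ; zero; suc; _+_; _*_; _∸_; _≤_; _≟_)
open import Data.Nat.Properties using () renaming (_≟_ to _≟ℕ_)
open import Data.Product using (_×_; _,_; ∃)
open import Data.Sum using (_⊎_)
open import Data.Product.Properties using (≡-dec)
open import Data.List using (List; []; _∷_; map; upTo; take; drop; length; filter; concatMap; _++_)
open import Data.List.Relation.Binary.Permutation.Propositional using (_↭_)
open import Data.Vec using (Vec; toList)
open import Relation.Binary.PropositionalEquality using (_≡_)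
open import Relation.Nullary using (Dec; yes; no)
open import Relation.Nullary.Decidable using (_×-dec_)
import Data.Bool.Properties as BP

range1 : ℕ → List ℕ
range1 k = map suc (upTo k)

range0 : ℕ → List ℕ
range0 k = upTo (suc k)

wt : List Bool → ℕ
wt bs = length (filter (λ b → b BP.≟ true) bs)

prefix : ℕ → List Bool → List Bool
prefix j t = take j t

suffix : ℕ → List Bool → List Bool
suffix j t = drop (length t ∸ j) t

Mstr : {n : ℕ} → Vec Bool n → List (ℕ × ℕ)
Mstr {n} v =
  map (λ j → (j ∸ wt (prefix j t) , wt (prefix j t))) (range1 n)
  ++ map (λ j → (j ∸ wt (suffix j t) , wt (suffix j t))) (range1 n)
  where t = toList v

MH : {n h : ℕ} → Vec (Vec Bool n) h → List (ℕ × ℕ)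
MH H = concatMap Mstr (toList H)

countPair : ℕ × ℕ → List (ℕ × ℕ) → ℕ
countPair p M = length (filter (λ q → ≡-dec _≟ℕ_ _≟ℕ_ q p) M)

-- cumulative weight function f : {0..n} × [2h] → {0..n}, written f l m
-- (values outside l ≤ n, 1 ≤ m ≤ 2h are irrelevant)
record IsCWF (n h : ℕ) (f : ℕ → ℕ → ℕ) : Set where
  field
    zero-start : ∀ m → 1 ≤ m → m ≤ 2 * h → f 0 m ≡ 0
    steps      : ∀ l m → 1 ≤ l → l ≤ n → 1 ≤ m → m ≤ 2 * h →
                 (f l m ≡ f (l ∸ 1) m) ⊎ (f l m ≡ suc (f (l ∸ 1) m))
    paired     : ∀ j → 1 ≤ j → j ≤ h →
                 ∃ λ w → ∀ l → l ≤ n → f l (2 * j ∸ 1) + f (n ∸ l) (2 * j) ≡ w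

pairsOf : ℕ → ℕ → (ℕ → ℕ → ℕ) → List (ℕ × ℕ)
pairsOf n h f = concatMap (λ m → map (λ l → (l ∸ f l m , f l m)) (range1 n)) (range1 (2 * h))

-- f is a solution to M (multiset equality = permutation of lists)
IsSolution : ℕ → ℕ → List (ℕ × ℕ) → (ℕ → ℕ → ℕ) → Set
IsSolution n h M f = M ↭ pairsOf n h f

aNum : ℕ → List (ℕ × ℕ) → ℕ → ℕ → ℕ
aNum h M zero zero = 2 * h
aNum h M l w = countPair (l ∸ w , w) M

bNum : ℕ → (ℕ → ℕ → ℕ) → ℕ → ℕ → ℕ
bNum h f l w = length (filter (λ m → (f l m ≟ℕ w) ×-dec (f (l ∸ 1) m ≟ℕ w)) (range1 (2 * h)))

cNum : ℕ → (ℕ → ℕ → ℕ) → ℕ → ℕ → ℕ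
cNum h f l zero = 0
cNum h f l (suc w) = length (filter (λ m → (f l m ≟ℕ suc w) ×-dec (f (l ∸ 1) m ≟ℕ w)) (range1 (2 * h)))

{-# OPTIONS --safe #-}

-- Since f_m(l) ≤ l, a pair (l - w, w) of M can only come from position l, so for l ≥ 1
-- a_{l,w} = |A(l,w)|, and also |A(0,0)| = 2h = a_{0,0}. Because each f_m grows by 0 or 1,
-- A(l,w) is the disjoint union of A(l,w) ∩ A(l-1,w) and A(l,w) ∩ A(l-1,w-1), and A(l-1,w)
-- that of A(l,w) ∩ A(l-1,w) and A(l,w+1) ∩ A(l-1,w); hence a_{l,w} = b_{l,w} + c_{l,w} and
-- a_{l-1,w} = b_{l,w} + c_{l,w+1}. Starting from c_{l,0} = 0 these equations successively
-- determine b_{l,0}, c_{l,1}, b_{l,1}, c_{l,2}, ...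
module Submission where

open import Defs
open import Data.Bool using (Bool)
open import Data.Nat using (ℕ; zero; suc; _+_; _*_; _∸_; _≤_; _<_; z≤n; s≤s; s≤s⁻¹; _≟_)
open import Data.Nat.Properties using (≤-trans; ≤-reflexive; m≤n⇒m≤1+n; n≤1+n;
  m∸n+n≡m; suc-injective; 1+n≢n; 1+n≢0; +-suc; +-identityʳ; +-cancelˡ-≡; +-cancelʳ-≡)
open import Data.Product using (_×_; _,_; proj₁; proj₂)
open import Data.Product.Properties using (,-injective; ≡-dec)
open import Data.Sum using (_⊎_; inj₁; inj₂; [_,_]′)
open import Data.Empty using (⊥-elim)
open import Data.List using (List; []; _∷_; _++_; map; length; filter; upTo; concatMap; [_])
open import Data.List.Properties using (length-++; length-map; length-upTo;
  filter-++; filter-all; filter-none; filter-accept; filter-reject)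
open import Data.List.Membership.Propositional using (_∈_)
open import Data.List.Membership.Propositional.Properties using (∈-map⁺; ∈-upTo⁺)
open import Data.List.Relation.Unary.All as All using (All; []; _∷_)
open import Data.List.Relation.Unary.All.Properties using (all-upTo) renaming (map⁺ to All-map⁺)
open import Data.List.Relation.Unary.Any using (here; there)
open import Data.List.Relation.Unary.Unique.Propositional using (Unique; []; _∷_)
open import Data.List.Relation.Unary.Unique.Propositional.Properties using (upTo⁺)
  renaming (map⁺ to Unique-map⁺)
open import Data.List.Relation.Binary.Permutation.Propositional using (_↭_)
open import Data.List.Relation.Binary.Permutation.Propositional.Properties using (↭-length; filter-↭)
open import Data.Vec using (Vec)
open import Function.Bundles using (_⇔_; mk⇔; Equivalence)
open import Relation.Binary.Definitions using (DecidableEquality)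
open import Relation.Binary.PropositionalEquality using (_≡_; refl; sym; trans; cong; cong₂; subst; module ≡-Reasoning)
open import Relation.Nullary using (¬_; yes; no)
open import Relation.Unary using (Pred; Decidable)
open import Relation.Unary.Properties using (_∪?_)
open import Level using (0ℓ)

private
  variable
    A B : Set

count : {P : Pred A 0ℓ} → Decidable P → List A → ℕ
count P? xs = length (filter P? xs)

count-++ : {P : Pred A 0ℓ} (P? : Decidable P) (xs ys : List A) →
  count P? (xs ++ ys) ≡ count P? xs + count P? ys
count-++ P? xs ys = trans (cong length (filter-++ P? xs ys)) (length-++ (filter P? xs))

count-↭ : {P : Pred A 0ℓ} (P? : Decidable P) {xs ys : List A} → xs ↭ ys → count P? xs ≡ count P? ys
count-↭ P? p = ↭-length (filter-↭ P? p)

count-none : {P : Pred A 0ℓ} (P? : Decidable P) {xs : List A} → All (λ x → ¬ P x) xs → count P? xs ≡ 0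
count-none P? ps = cong length (filter-none P? ps)

count-map : {P : Pred A 0ℓ} (P? : Decidable P) (g : B → A) (xs : List B) →
  count P? (map g xs) ≡ count (λ x → P? (g x)) xs
count-map P? g [] = refl
count-map P? g (x ∷ xs) with P? (g x)
... | yes _ = cong suc (count-map P? g xs)
... | no _  = count-map P? g xs

count-concatMap : {P : Pred A 0ℓ} {Q : Pred B 0ℓ} (P? : Decidable P) (Q? : Decidable Q)
  (g : B → List A) (ys : List B) →
  All (λ y → count P? (g y) ≡ count Q? [ y ]) ys → count P? (concatMap g ys) ≡ count Q? ys
count-concatMap P? Q? g [] [] = refl
count-concatMap P? Q? g (y ∷ ys) (e ∷ es) = begin
  count P? (g y ++ concatMap g ys)           ≡⟨ count-++ P? (g y) (concatMap g ys) ⟩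
  count P? (g y) + count P? (concatMap g ys) ≡⟨ cong₂ _+_ e (count-concatMap P? Q? g ys es) ⟩
  count Q? [ y ] + count Q? ys               ≡⟨ sym (count-++ Q? [ y ] ys) ⟩
  count Q? (y ∷ ys)                          ∎
  where open ≡-Reasoning

count-cong : {P Q : Pred A 0ℓ} (P? : Decidable P) (Q? : Decidable Q) {xs : List A} →
  All (λ x → P x ⇔ Q x) xs → count P? xs ≡ count Q? xs
count-cong P? Q? {[]} [] = refl
count-cong P? Q? {x ∷ xs} (P⇔Q ∷ ps) with P? x | Q? x
... | yes _ | yes _ = cong suc (count-cong P? Q? ps)
... | yes p | no ¬q = ⊥-elim (¬q (Equivalence.to P⇔Q p))
... | no ¬p | yes q = ⊥-elim (¬p (Equivalence.from P⇔Q q))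
... | no _  | no _  = count-cong P? Q? ps

count-∪ : {P Q : Pred A 0ℓ} (P? : Decidable P) (Q? : Decidable Q) → (∀ {x} → P x → ¬ Q x) →
  (xs : List A) → count (P? ∪? Q?) xs ≡ count P? xs + count Q? xs
count-∪ P? Q? disjoint [] = refl
count-∪ P? Q? disjoint (x ∷ xs) with P? x | Q? x
... | yes p | yes q = ⊥-elim (disjoint p q)
... | yes _ | no _  = cong suc (count-∪ P? Q? disjoint xs)
... | no _  | yes _ = trans (cong suc (count-∪ P? Q? disjoint xs)) (sym (+-suc _ _))
... | no _  | no _  = count-∪ P? Q? disjoint xs

count-unique : (_≟ᴬ_ : DecidableEquality A) {x : A} {xs : List A} →
  Unique xs → x ∈ xs → count (_≟ᴬ x) xs ≡ 1
count-unique _≟ᴬ_ (y≢xs ∷ _) (here refl) =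
  trans (cong length (filter-accept (_≟ᴬ _) refl))
        (cong suc (count-none (_≟ᴬ _) (All.map (λ y≢z z≡y → y≢z (sym z≡y)) y≢xs)))
count-unique _≟ᴬ_ (y≢xs ∷ xs-unique) (there x∈xs) =
  trans (cong length (filter-reject (_≟ᴬ _) (All.lookup y≢xs x∈xs)))
        (count-unique _≟ᴬ_ xs-unique x∈xs)

all-range1 : ∀ {k} {P : Pred ℕ 0ℓ} → (∀ {m} → 1 ≤ m → m ≤ k → P m) → All P (range1 k)
all-range1 {k} P-in-range = All-map⁺ (All.map (P-in-range (s≤s z≤n)) (all-upTo k))

length-range1 : ∀ k → length (range1 k) ≡ k
length-range1 k = trans (length-map suc (upTo k)) (length-upTo k)

range1-unique : ∀ k → Unique (range1 k)
range1-unique k = Unique-map⁺ suc-injective (upTo⁺ k)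

∈-range1 : ∀ {k l} → 1 ≤ l → l ≤ k → l ∈ range1 k
∈-range1 {l = suc l} _ l<k = ∈-map⁺ suc (∈-upTo⁺ l<k)

∸-,-injectiveˡ : ∀ {x y x′ y′} → y ≤ x → y′ ≤ x′ → (x ∸ y , y) ≡ (x′ ∸ y′ , y′) → x ≡ x′
∸-,-injectiveˡ {x} {y} {x′} {y′} y≤x y′≤x′ eq with ,-injective eq
... | eq₁ , eq₂ = begin
  x                ≡⟨ sym (m∸n+n≡m y≤x) ⟩
  (x ∸ y) + y      ≡⟨ cong₂ _+_ eq₁ eq₂ ⟩
  (x′ ∸ y′) + y′   ≡⟨ m∸n+n≡m y′≤x′ ⟩
  x′               ∎
  where open ≡-Reasoning

staircase-unique : ∀ {k} {b c b′ c′ : ℕ → ℕ} → c 0 ≡ c′ 0 →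
  (∀ w → w ≤ k → b w + c w ≡ b′ w + c′ w) →
  (∀ w → w < k → b w + c (suc w) ≡ b′ w + c′ (suc w)) →
  ∀ w → w ≤ k → b w ≡ b′ w × c w ≡ c′ w
staircase-unique {k} {b} {c} {b′} {c′} c₀ diagonal subdiagonal w w≤k = b-eq w w≤k , c-eq w w≤k
  where
  b-eq : ∀ w → w ≤ k → b w ≡ b′ w
  c-eq : ∀ w → w ≤ k → c w ≡ c′ w
  b-eq w w≤k = +-cancelʳ-≡ (c w) (b w) (b′ w)
    (trans (diagonal w w≤k) (cong (b′ w +_) (sym (c-eq w w≤k))))
  c-eq zero _ = c₀
  c-eq (suc w) w<k = +-cancelˡ-≡ (b′ w) (c (suc w)) (c′ (suc w))
    (trans (cong (_+ c (suc w)) (sym (b-eq w (≤-trans (n≤1+n w) w<k)))) (subdiagonal w w<k))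

cardA : ℕ → (ℕ → ℕ → ℕ) → ℕ → ℕ → ℕ
cardA h f l w = count (λ m → f l m ≟ w) (range1 (2 * h))

module _ {n h : ℕ} {f : ℕ → ℕ → ℕ} (cwf : IsCWF n h f) where
  open IsCWF cwf

  cwf-≤ : ∀ {l m} → l ≤ n → 1 ≤ m → m ≤ 2 * h → f l m ≤ l
  cwf-≤ {zero} {m} _ 1≤m m≤2h = ≤-reflexive (zero-start m 1≤m m≤2h)
  cwf-≤ {suc l} {m} l<n 1≤m m≤2h with steps (suc l) m (s≤s z≤n) l<n 1≤m m≤2h
  ... | inj₁ eq = ≤-trans (≤-reflexive eq) (m≤n⇒m≤1+n (cwf-≤ (≤-trans (n≤1+n l) l<n) 1≤m m≤2h))
  ... | inj₂ eq = ≤-trans (≤-reflexive eq) (s≤s (cwf-≤ (≤-trans (n≤1+n l) l<n) 1≤m m≤2h))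

  cardA-zero : cardA h f 0 0 ≡ 2 * h
  cardA-zero = trans
    (cong length (filter-all (λ m → f 0 m ≟ 0) (all-range1 (zero-start _))))
    (length-range1 (2 * h))

  cwf-pair-injective : ∀ {l l′ w m} → l′ ≤ n → 1 ≤ m → m ≤ 2 * h → w ≤ l →
    (l′ ∸ f l′ m , f l′ m) ≡ (l ∸ w , w) → l′ ≡ l
  cwf-pair-injective l′≤n 1≤m m≤2h = ∸-,-injectiveˡ (cwf-≤ l′≤n 1≤m m≤2h)

  countPair-row : ∀ {l w m} → 1 ≤ l → l ≤ n → w ≤ l → 1 ≤ m → m ≤ 2 * h →
    countPair (l ∸ w , w) (map (λ l′ → (l′ ∸ f l′ m , f l′ m)) (range1 n)) ≡
    count (λ m → f l m ≟ w) [ m ]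
  countPair-row {l} {w} {m} 1≤l l≤n w≤l 1≤m m≤2h with f l m ≟ w
  ... | yes fl≡w = trans (count-map _ _ (range1 n)) (begin
    count (λ l′ → ≡-dec _≟_ _≟_ (l′ ∸ f l′ m , f l′ m) (l ∸ w , w)) (range1 n)
      ≡⟨ count-cong _ (_≟ l) (all-range1 λ _ l′≤n →
           mk⇔ (cwf-pair-injective l′≤n 1≤m m≤2h w≤l) (λ { refl → cong (λ v → l ∸ v , v) fl≡w })) ⟩
    count (_≟ l) (range1 n)
      ≡⟨ count-unique _≟_ (range1-unique n) (∈-range1 1≤l l≤n) ⟩
    1
      ≡⟨ cong length (filter-accept (λ m → f l m ≟ w) fl≡w) ⟨
    count (λ m → f l m ≟ w) [ m ] ∎)
    where open ≡-Reasoning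
  ... | no fl≢w = trans (count-map _ _ (range1 n))
    (trans (count-none _ (all-range1 λ _ l′≤n eq →
             fl≢w (subst (λ l′ → f l′ m ≡ w) (cwf-pair-injective l′≤n 1≤m m≤2h w≤l eq)
                         (proj₂ (,-injective eq)))))
           (sym (cong length (filter-reject (λ m → f l m ≟ w) fl≢w))))

  countPair-pairsOf : ∀ {l w} → 1 ≤ l → l ≤ n → w ≤ l →
    countPair (l ∸ w , w) (pairsOf n h f) ≡ cardA h f l w
  countPair-pairsOf 1≤l l≤n w≤l =
    count-concatMap _ _ _ (range1 (2 * h)) (all-range1 (countPair-row 1≤l l≤n w≤l))

  cardA≡aNum : ∀ {M l w} → IsSolution n h M f → 1 ≤ l → l ≤ n → w ≤ l →
    cardA h f l w ≡ aNum h M l w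
  cardA≡aNum {l = suc l} {w} M↭pairs 1≤l l≤n w≤l =
    sym (trans (count-↭ (λ q → ≡-dec _≟_ _≟_ q (suc l ∸ w , w)) M↭pairs)
               (countPair-pairsOf 1≤l l≤n w≤l))

  cardA≡b+c : ∀ {l} → 1 ≤ l → l ≤ n → ∀ w → cardA h f l w ≡ bNum h f l w + cNum h f l w
  cardA≡b+c {l} 1≤l l≤n zero =
    trans (count-cong _ _ (all-range1 λ 1≤m m≤2h → mk⇔ (λ e → e , stays-zero 1≤m m≤2h e) proj₁))
          (sym (+-identityʳ _))
    where
    stays-zero : ∀ {m} → 1 ≤ m → m ≤ 2 * h → f l m ≡ 0 → f (l ∸ 1) m ≡ 0
    stays-zero {m} 1≤m m≤2h e with steps l m 1≤l l≤n 1≤m m≤2h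
    ... | inj₁ same = trans (sym same) e
    ... | inj₂ up = ⊥-elim (1+n≢0 (trans (sym up) e))
  cardA≡b+c {l} 1≤l l≤n (suc w) =
    trans (count-cong _ _ (all-range1 λ 1≤m m≤2h → mk⇔ (came-from 1≤m m≤2h) [ proj₁ , proj₁ ]′))
          (count-∪ _ _ (λ (_ , e) (_ , e′) → 1+n≢n (trans (sym e) e′)) (range1 (2 * h)))
    where
    came-from : ∀ {m} → 1 ≤ m → m ≤ 2 * h → f l m ≡ suc w →
      (f l m ≡ suc w × f (l ∸ 1) m ≡ suc w) ⊎ (f l m ≡ suc w × f (l ∸ 1) m ≡ w)
    came-from {m} 1≤m m≤2h e with steps l m 1≤l l≤n 1≤m m≤2h
    ... | inj₁ same = inj₁ (e , trans (sym same) e)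
    ... | inj₂ up = inj₂ (e , suc-injective (trans (sym up) e))

  cardA-pred≡b+c : ∀ {l} → 1 ≤ l → l ≤ n → ∀ w →
    cardA h f (l ∸ 1) w ≡ bNum h f l w + cNum h f l (suc w)
  cardA-pred≡b+c {l} 1≤l l≤n w =
    trans (count-cong _ _ (all-range1 λ 1≤m m≤2h → mk⇔ (goes-to 1≤m m≤2h) [ proj₂ , proj₂ ]′))
          (count-∪ _ _ (λ (e , _) (e′ , _) → 1+n≢n (trans (sym e′) e)) (range1 (2 * h)))
    where
    goes-to : ∀ {m} → 1 ≤ m → m ≤ 2 * h → f (l ∸ 1) m ≡ w →
      (f l m ≡ w × f (l ∸ 1) m ≡ w) ⊎ (f l m ≡ suc w × f (l ∸ 1) m ≡ w)
    goes-to {m} 1≤m m≤2h e with steps l m 1≤l l≤n 1≤m m≤2h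
    ... | inj₁ same = inj₁ (trans same e , e)
    ... | inj₂ up = inj₂ (trans up (cong suc e) , e)

cardA-determined : ∀ {n h f f′ M M′} →
  IsCWF n h f → IsSolution n h M f → IsCWF n h f′ → IsSolution n h M′ f′ →
  (∀ l w → l ≤ n → w ≤ l → aNum h M l w ≡ aNum h M′ l w) →
  ∀ l w → l ≤ n → w ≤ l → cardA h f l w ≡ cardA h f′ l w
cardA-determined cwf _ cwf′ _ _ zero zero _ _ = trans (cardA-zero cwf) (sym (cardA-zero cwf′))
cardA-determined {h = h} {f} {f′} {M} {M′} cwf sol cwf′ sol′ a≡a′ (suc l) w l<n w≤l = begin
  cardA h f (suc l) w   ≡⟨ cardA≡aNum cwf sol (s≤s z≤n) l<n w≤l ⟩
  aNum h M (suc l) w    ≡⟨ a≡a′ (suc l) w l<n w≤l ⟩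
  aNum h M′ (suc l) w   ≡⟨ cardA≡aNum cwf′ sol′ (s≤s z≤n) l<n w≤l ⟨
  cardA h f′ (suc l) w  ∎
  where open ≡-Reasoning

proposition4 : (n h : ℕ) → 1 ≤ n → 1 ≤ h →
    (H H′ : Vec (Vec Bool n) h) (f f′ : ℕ → ℕ → ℕ) →
    IsCWF n h f → IsSolution n h (MH H) f →
    IsCWF n h f′ → IsSolution n h (MH H′) f′ →
    (∀ l w → l ≤ n → w ≤ l → aNum h (MH H) l w ≡ aNum h (MH H′) l w) →
    ∀ l w → 1 ≤ l → l ≤ n → w ≤ l →
    (bNum h f l w ≡ bNum h f′ l w) × (cNum h f l w ≡ cNum h f′ l w)
proposition4 n h _ _ _ _ f f′ cwf sol cwf′ sol′ a≡a′ l@(suc l₀) w 1≤l l≤n w≤l =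
  staircase-unique {b = b} {c} {b′} {c′} refl diagonal subdiagonal w w≤l
  where
  open ≡-Reasoning

  b c b′ c′ : ℕ → ℕ
  b  = bNum h f l
  c  = cNum h f l
  b′ = bNum h f′ l
  c′ = cNum h f′ l

  cardA≡ : ∀ l w → l ≤ n → w ≤ l → cardA h f l w ≡ cardA h f′ l w
  cardA≡ = cardA-determined cwf sol cwf′ sol′ a≡a′

  diagonal : ∀ w → w ≤ l → b w + c w ≡ b′ w + c′ w
  diagonal w w≤l = begin
    b w + c w          ≡⟨ cardA≡b+c cwf 1≤l l≤n w ⟨
    cardA h f l w      ≡⟨ cardA≡ l w l≤n w≤l ⟩
    cardA h f′ l w     ≡⟨ cardA≡b+c cwf′ 1≤l l≤n w ⟩
    b′ w + c′ w        ∎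

  subdiagonal : ∀ w → w < l → b w + c (suc w) ≡ b′ w + c′ (suc w)
  subdiagonal w w<l = begin
    b w + c (suc w)    ≡⟨ cardA-pred≡b+c cwf 1≤l l≤n w ⟨
    cardA h f l₀ w     ≡⟨ cardA≡ l₀ w (≤-trans (n≤1+n l₀) l≤n) (s≤s⁻¹ w<l) ⟩
    cardA h f′ l₀ w    ≡⟨ cardA-pred≡b+c cwf′ 1≤l l≤n w ⟩
    b′ w + c′ (suc w)  ∎
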